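{- Let $G$ be a finite loopless $4$-regular planar graph (parallel edges allowed). Then $\mathrm{hn}_{cc}(G)\le \frac{1}{2}|V(G)|$. Furthermore, this bound is tight: there exists a loopless $4$-regular planar graph $G$ with $\mathrm{hn}_{cc}(G)=\frac{1}{2}|V(G)|$.
   Context: Graphs are finite and loopless, and may have parallel edges (the edge set is a multiset); the degree of a vertex counts edges with multiplicity, and $G$ is $4$-regular if every vertex has degree $4$. A cycle is a closed walk $(v_1,\dots,v_q,v_1)$ with at least one edge in which the only repeated vertex is $v_1$; in particular two distinct parallel edges between $u$ and $v$ form a cycle of length $2$. For $S\subseteq V(G)$ let $I_{cc}(S)=S\cup\{v\in V(G): \text{there is a cycle } C \text{ of } G \text{ with } V(C)\setminus S=\{v\}\}$. A set $S$ is convex if $I_{cc}(S)=S$. The convex hull $\mathrm{hull}(S)$ is the inclusion-wise smallest convex set containing $S$. $S$ is a hull set if $\mathrm{hull}(S)=V(G)$, and $\mathrm{hn}_{cc}(G)$ is the minimum cardinality of a hull set of $G$. -}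

module Defs where

open import Level using (0ℓ)
open import Data.Nat using (ℕ; zero; suc; _+_; _*_; _≤_)
open import Data.Bool using (Bool; true; false; not; if_then_else_)
open import Data.Fin using (Fin; zero; suc; _≟_)
open import Data.Fin.Subset using (Subset; _∈_; _∉_)
open import Data.List using (allFin; map)
open import Data.Nat.ListAction using (sum)
open import Data.Product using (_×_; _,_; proj₁; proj₂; Σ; ∃)
open import Data.Sum using (_⊎_)
open import Function.Definitions using (Injective)
open import Relation.Nullary using (¬_)
open import Relation.Nullary.Decidable using (⌊_⌋)
open import Relation.Binary using (Rel)
open import Relation.Binary.PropositionalEquality using (_≡_; _≢_)
open import Relation.Binary.Construct.Closure.ReflexiveTransitive using (Star)
open import Relation.Binary.Construct.Closure.Equivalence using (EqClosure)

-- Finite multigraphs: vertices Fin n, edges Fin m (a multiset of edges),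
-- each edge given by its (ordered, but read unordered) pair of ends.

Graph : ℕ → ℕ → Set
Graph n m = Fin m → Fin n × Fin n

module _ {n m : ℕ} (G : Graph n m) where

  Loopless : Set
  Loopless = ∀ e → proj₁ (G e) ≢ proj₂ (G e)

  degree : Fin n → ℕ
  degree v = sum (map (λ e → ind (proj₁ (G e)) + ind (proj₂ (G e))) (allFin m))
    where
    ind : Fin n → ℕ
    ind a = if ⌊ a ≟ v ⌋ then 1 else 0

  FourRegular : Set
  FourRegular = ∀ v → degree v ≡ 4

  Joins : Fin m → Fin n → Fin n → Set
  Joins e a b = (G e ≡ (a , b)) ⊎ (G e ≡ (b , a))

-- Cyclic successor on Fin (suc k): i ↦ i+1 mod (suc k)

csuc : ∀ {k} → Fin (suc k) → Fin (suc k)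
csuc {zero} zero = zero
csuc {suc k} zero = suc zero
csuc {suc k} (suc i) with csuc i
... | zero = zero
... | suc j = suc (suc j)

-- Cycles: (v_0, ..., v_{q-1}, v_0) with q = suc k ≥ 1 edges, pairwise
-- distinct vertices and pairwise distinct edges, edge i joining v_i and
-- v_{i+1 mod q}.

record Cycle {n m : ℕ} (G : Graph n m) : Set where
  field
    k     : ℕ
    verts : Fin (suc k) → Fin n
    edges : Fin (suc k) → Fin m
    verts-inj : Injective _≡_ _≡_ verts
    edges-inj : Injective _≡_ _≡_ edges
    joins : ∀ i → Joins G (edges i) (verts i) (verts (csuc i))

module _ {n m : ℕ} (G : Graph n m) where

  -- V(C) \ S = {v}
  OnlyOutside : Cycle G → Subset n → Fin n → Set
  OnlyOutside C S v =
    (∃ λ i → Cycle.verts C i ≡ v) × v ∉ S ×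
    (∀ i → Cycle.verts C i ∉ S → Cycle.verts C i ≡ v)

  -- S is convex iff I_cc(S) = S, i.e. I_cc(S) ⊆ S
  Convex : Subset n → Set
  Convex S = ∀ (C : Cycle G) v → OnlyOutside C S v → v ∈ S

  -- hull(S) = V(G), with hull(S) the intersection of all convex
  -- supersets of S (the smallest convex set containing S)
  HullSet : Subset n → Set
  HullSet S = ∀ T → (∀ {v} → v ∈ S → v ∈ T) → Convex T → ∀ v → v ∈ T

NumClasses : {A : Set} → Rel A 0ℓ → ℕ → Set
NumClasses {A} R k =
  Σ (Fin k → A) λ r →
    (∀ x → ∃ λ i → EqClosure R (r i) x) ×
    (∀ i j → EqClosure R (r i) (r j) → i ≡ j)

Dart : ℕ → Set
Dart m = Fin m × Bool

flip : ∀ {m} → Dart m → Dart m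
flip (e , b) = (e , not b)

module _ {n m : ℕ} (G : Graph n m) where

  tail : Dart m → Fin n
  tail (e , true)  = proj₁ (G e)
  tail (e , false) = proj₂ (G e)

  record Rotation : Set where
    field
      σ  : Dart m → Dart m
      σ⁻ : Dart m → Dart m
      σσ⁻ : ∀ d → σ (σ⁻ d) ≡ d
      σ⁻σ : ∀ d → σ⁻ (σ d) ≡ d
      σ-tail : ∀ d → tail (σ d) ≡ tail d
      σ-trans : ∀ d d' → tail d ≡ tail d' → Star (λ x y → y ≡ σ x) d d'

  -- G is planar iff it has a rotation system of genus 0 on every
  -- component:  #vertex-orbits − #edges + #faces = 2 · #components
  -- (vertex orbits = orbits of σ, faces = orbits of σ ∘ flip,
  --  components = orbits of ⟨σ , flip⟩; isolated vertices carry no darts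
  --  and do not affect planarity).
  Planar : Set
  Planar = Σ Rotation λ ρ → let open Rotation ρ in
    Σ ℕ λ v → Σ ℕ λ f → Σ ℕ λ c →
      NumClasses (λ x y → y ≡ σ x) v ×
      NumClasses (λ x y → y ≡ σ (flip x)) f ×
      NumClasses (λ x y → (y ≡ σ x) ⊎ (y ≡ flip x)) c ×
      v + f ≡ m + 2 * c

{-# OPTIONS --safe #-}
module Submission where

-- Add the vertices one at a time to a set P, keeping a set S ⊆ P with P ⊆ hull(S) and
-- labels identifying connected pieces of G[P]. If the new vertex x has two edges into one piece, they
-- close a cycle through a path in that piece which leaves hull(S) only at x, so x ∈ hull(S); otherwise
-- x joins S. With ∂P the number of edges leaving P and o the number of labels whose piece still has an
-- edge leaving P, the invariant 4|S| + 2o ≤ 2|P| + ∂P survives every step provided x has an edge leaving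
-- P ∪ {x} unless no vertex of P ∪ {x} has one (such an order exists: choose it from the last vertex
-- backwards). Indeed, by 4-regularity x has at most four edges back into P, and at most three if its own
-- piece is still open. At the end ∂ = o = 0, so 2|S| ≤ |V|.
--
-- Tightness. In the dipole (two vertices joined by four parallel edges) one vertex is a hull set, and no
-- hull set is empty because the empty set is convex in a loopless graph.

open import Defs
open import Level using (0ℓ)
open import Data.Bool using (Bool; true; false; T; not; _∧_; _∨_; _xor_; if_then_else_)
open import Data.Bool.Properties using (T?; T-≡; xor-comm)
open import Data.Empty using (⊥-elim)
open import Data.Fin using (Fin; zero; suc; _≟_; inject₁)
open import Data.Fin.Properties using (any?; suc-injective)
open import Data.Fin.Subset using (Subset; _∈_; _∉_; ∣_∣; ⊥; ⁅_⁆)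
open import Data.Fin.Subset.Properties
  using (_∈?_; ∉⊥; nonempty?; ∣⁅x⁆∣≡1; x∈⁅x⁆; x∈⁅y⁆⇒x≡y; p⊆q⇒∣p∣≤∣q∣)
import Data.List as List
open import Data.List using (_∷_; [])
import Data.List.Properties as List
open import Data.Nat using (ℕ; zero; suc; _+_; _*_; _≤_; z≤n; s≤s)
import Data.Nat.ListAction as ListSum
import Data.Nat.Properties as ℕ
open import Data.Nat.Properties
  using (+-*-semiring; +-comm; +-identityʳ; +-mono-≤; +-monoˡ-≤; +-monoʳ-≤; *-monoʳ-≤; +-cancelʳ-≤;
         ≤-refl; ≤-trans; ≤-reflexive; m≤m+n; m≤n+m; module ≤-Reasoning)
open import Data.Nat.Tactic.RingSolver using (solve)
open import Algebra.Properties.Semiring.Sum +-*-semiring using (sum; ∑-distrib-+; sum-cong-≗; *-distribˡ-sum)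
open import Data.Product using (_×_; _,_; proj₁; proj₂; Σ; ∃; ∃₂)
open import Data.Sum using (_⊎_; inj₁; inj₂; [_,_])
open import Data.Unit using (⊤; tt)
open import Data.Vec using (tabulate)
open import Data.Vec.Properties using (lookup∘tabulate; lookup⇒[]=)
open import Function using (_∘_; id; _⇔_; Equivalence; mk⇔)
open import Relation.Binary using (Rel)
open import Relation.Binary.Construct.Closure.Equivalence using (EqClosure)
open import Relation.Binary.Construct.Closure.ReflexiveTransitive as Star using (Star; ε; _◅_; _◅◅_)
open import Relation.Binary.Construct.Closure.Symmetric using (fwd; bwd)
open import Relation.Binary.PropositionalEquality
  using (_≡_; _≢_; refl; sym; trans; cong; cong₂; subst; module ≡-Reasoning)
open import Relation.Nullary using (Dec; yes; no; does; ¬_; contradiction)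
open import Relation.Nullary.Decidable using (isYes; does-⇔; _×-dec_; _⊎-dec_; ¬?; dec-true; dec-false)
open import Relation.Unary using (Pred; Decidable)

-- Counting

𝟙 : ∀ {a} {A : Set a} → Dec A → ℕ
𝟙 a? = if does a? then 1 else 0

𝟙≤1 : ∀ {a} {A : Set a} (a? : Dec A) → 𝟙 a? ≤ 1
𝟙≤1 (yes _) = s≤s z≤n
𝟙≤1 (no _)  = z≤n

𝟙-yes : ∀ {a} {A : Set a} (a? : Dec A) → A → 𝟙 a? ≡ 1
𝟙-yes a? a = cong (λ b → if b then 1 else 0) (dec-true a? a)

𝟙-no : ∀ {a} {A : Set a} (a? : Dec A) → ¬ A → 𝟙 a? ≡ 0
𝟙-no a? ¬a = cong (λ b → if b then 1 else 0) (dec-false a? ¬a)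

𝟙-⊎ : ∀ {a b} {A : Set a} {B : Set b} (a? : Dec A) (b? : Dec B) → 𝟙 (a? ⊎-dec b?) ≤ 𝟙 a? + 𝟙 b?
𝟙-⊎ (yes _) _       = s≤s z≤n
𝟙-⊎ (no _)  (yes _) = s≤s z≤n
𝟙-⊎ (no _)  (no _)  = z≤n

𝟙-mono : ∀ {a b} {A : Set a} {B : Set b} → (A → B) → (a? : Dec A) (b? : Dec B) → 𝟙 a? ≤ 𝟙 b?
𝟙-mono f (yes a) (yes _) = ≤-refl
𝟙-mono f (yes a) (no ¬b) = contradiction (f a) ¬b
𝟙-mono f (no _)  b?      = z≤n

sum-mono-≤ : ∀ {k} {f g : Fin k → ℕ} → (∀ i → f i ≤ g i) → sum f ≤ sum g
sum-mono-≤ {zero}  f≤g = z≤n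
sum-mono-≤ {suc k} f≤g = +-mono-≤ (f≤g zero) (sum-mono-≤ (f≤g ∘ suc))

count : ∀ {k a} {A : Pred (Fin k) a} → Decidable A → ℕ
count A? = sum (λ i → 𝟙 (A? i))

module _ {k a b} {A : Pred (Fin k) a} {B : Pred (Fin k) b} (A? : Decidable A) (B? : Decidable B) where

  count-mono : (∀ {i} → A i → B i) → count A? ≤ count B?
  count-mono A⊆B = sum-mono-≤ (λ i → 𝟙-mono A⊆B (A? i) (B? i))

  count-cong : (∀ {i} → A i ⇔ B i) → count A? ≡ count B?
  count-cong A⇔B = sum-cong-≗ (λ i → cong (λ b → if b then 1 else 0) (does-⇔ A⇔B (A? i) (B? i)))

count-empty : ∀ {k a} {A : Pred (Fin k) a} (A? : Decidable A) → (∀ i → ¬ A i) → count A? ≡ 0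
count-empty {zero}  A? ∅ = refl
count-empty {suc k} A? ∅ with A? zero
... | yes a = contradiction a (∅ zero)
... | no _  = count-empty (A? ∘ suc) (∅ ∘ suc)

count-singleton : ∀ {k} (x : Fin k) → count (_≟ x) ≡ 1
count-singleton {suc k} zero    = cong suc (count-empty {k} (λ i → suc i ≟ zero) (λ i ()))
count-singleton {suc k} (suc x) = trans (count-cong (λ i → suc i ≟ suc x) (_≟ x) (mk⇔ suc-injective (cong suc)))
                                        (count-singleton x)

count-pos : ∀ {k a} {A : Pred (Fin k) a} (A? : Decidable A) {x} → A x → 1 ≤ count A?
count-pos A? {x} a = ≤-trans (≤-reflexive (sym (count-singleton x))) (count-mono (_≟ x) A? (λ { refl → a }))

count-remove : ∀ {k a} {A : Pred (Fin k) a} (A? : Decidable A) {x} → A x →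
               count A? ≡ suc (count (λ i → A? i ×-dec ¬? (i ≟ x)))
count-remove {A = A} A? {x} a = begin
  count A?                                         ≡⟨ sum-cong-≗ split ⟩
  sum (λ i → 𝟙 (i ≟ x) + 𝟙 (A∖x? i))               ≡⟨ ∑-distrib-+ (λ i → 𝟙 (i ≟ x)) (𝟙 ∘ A∖x?) ⟩
  count (_≟ x) + count A∖x?                        ≡⟨ cong (_+ count A∖x?) (count-singleton x) ⟩
  suc (count A∖x?)                                 ∎
  where
  open ≡-Reasoning
  A∖x? : Decidable (λ i → A i × i ≢ x)
  A∖x? i = A? i ×-dec ¬? (i ≟ x)
  split : ∀ i → 𝟙 (A? i) ≡ 𝟙 (i ≟ x) + 𝟙 (A∖x? i)
  split i with A? i | i ≟ x
  ... | yes _  | yes _  = refl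
  ... | yes _  | no _   = refl
  ... | no ¬ai | yes refl = contradiction a ¬ai
  ... | no _   | no _   = refl

count-injection : ∀ {k l a b} {A : Pred (Fin k) a} {B : Pred (Fin l) b} (A? : Decidable A) (B? : Decidable B)
                  (f : Fin k → Fin l) → (∀ {i} → A i → B (f i)) →
                  (∀ {i j} → A i → A j → f i ≡ f j → i ≡ j) → count A? ≤ count B?
count-injection {zero}  A? B? f maps inj = z≤n
count-injection {suc k} {B = B} A? B? f maps inj with A? zero
... | no _   = count-injection (A? ∘ suc) B? (f ∘ suc) maps (λ ai aj → suc-injective ∘ inj ai aj)
... | yes a₀ = ≤-trans (s≤s rest) (≤-reflexive (sym (count-remove B? (maps a₀))))
  where
  B∖f₀? : Decidable (λ j → B j × j ≢ f zero)
  B∖f₀? j = B? j ×-dec ¬? (j ≟ f zero)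
  rest : count (A? ∘ suc) ≤ count B∖f₀?
  rest = count-injection (A? ∘ suc) B∖f₀? (f ∘ suc) (λ ai → maps ai , λ eq → contradiction (inj ai a₀ eq) λ ())
                         (λ ai aj → suc-injective ∘ inj ai aj)

size : ∀ {k} → (Fin k → Bool) → ℕ
size P = count (T? ∘ P)

∈-tabulate : ∀ {k} (S : Fin k → Bool) {v} → T (S v) → v ∈ tabulate S
∈-tabulate S {v} s = lookup⇒[]= v (tabulate S) (trans (lookup∘tabulate S v) (Equivalence.to T-≡ s))

∣tabulate∣≡size : ∀ {k} (S : Fin k → Bool) → ∣ tabulate S ∣ ≡ size S
∣tabulate∣≡size {zero}  S = refl
∣tabulate∣≡size {suc k} S with S zero
... | true  = cong suc (∣tabulate∣≡size (S ∘ suc))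
... | false = ∣tabulate∣≡size (S ∘ suc)

size-full : ∀ {k} → size (λ (_ : Fin k) → true) ≡ k
size-full {zero}  = refl
size-full {suc k} = cong suc size-full

record Insertion {k} (P : Fin k → Bool) (x : Fin k) (P′ : Fin k → Bool) : Set where
  field
    fresh     : P x ≡ false
    added     : P′ x ≡ true
    unchanged : ∀ {v} → v ≢ x → P′ v ≡ P v

  x∉P : ¬ T (P x)
  x∉P p = subst T fresh p

  x∈P′ : T (P′ x)
  x∈P′ = subst T (sym added) _

  old⇒new : ∀ {v} → T (P v) → T (P′ v)
  old⇒new {v} p with v ≟ x
  ... | yes refl = contradiction p x∉P
  ... | no v≢x   = subst T (sym (unchanged v≢x)) p

  new⇒old : ∀ {v} → v ≢ x → T (P′ v) → T (P v)
  new⇒old v≢x = subst T (unchanged v≢x)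

  size-insertion : size P′ ≡ suc (size P)
  size-insertion = trans (count-remove (T? ∘ P′) x∈P′)
                         (cong suc (count-cong (λ i → T? (P′ i) ×-dec ¬? (i ≟ x)) (T? ∘ P)
                           (mk⇔ (λ (p′ , v≢x) → new⇒old v≢x p′) (λ p → old⇒new p , λ { refl → x∉P p }))))

insert : ∀ {k} → Fin k → (Fin k → Bool) → Fin k → Bool
insert x P v = does (v ≟ x) ∨ P v

remove : ∀ {k} → Fin k → (Fin k → Bool) → Fin k → Bool
remove x P v = not (does (v ≟ x)) ∧ P v

insertion-insert : ∀ {k} {P : Fin k → Bool} {x} → ¬ T (P x) → Insertion P x (insert x P)
insertion-insert {P = P} {x} x∉P = record { fresh = fresh (P x) x∉P ; added = added ; unchanged = unchanged }
  where
  fresh : ∀ b → ¬ T b → b ≡ false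
  fresh false _  = refl
  fresh true  ¬t = contradiction _ ¬t
  added : insert x P x ≡ true
  added = cong (_∨ P x) (dec-true (x ≟ x) refl)
  unchanged : ∀ {v} → v ≢ x → insert x P v ≡ P v
  unchanged {v} v≢x = cong (_∨ P v) (dec-false (v ≟ x) v≢x)

insertion-remove : ∀ {k} {P : Fin k → Bool} {x} → T (P x) → Insertion (remove x P) x P
insertion-remove {P = P} {x} x∈P =
  record { fresh = fresh ; added = Equivalence.to T-≡ x∈P ; unchanged = unchanged }
  where
  fresh : remove x P x ≡ false
  fresh = cong (λ b → not b ∧ P x) (dec-true (x ≟ x) refl)
  unchanged : ∀ {v} → v ≢ x → P v ≡ remove x P v
  unchanged {v} v≢x = cong (λ b → not b ∧ P v) (sym (dec-false (v ≟ x) v≢x))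

-- Walks, and the cycle closed by an ear

module Walks {n m : ℕ} (G : Graph n m) where

  joins-sym : ∀ {e a b} → Joins G e a b → Joins G e b a
  joins-sym (inj₁ eq) = inj₂ eq
  joins-sym (inj₂ eq) = inj₁ eq

  joins-ends : ∀ {e a b u v} → Joins G e a b → Joins G e u v → a ≡ u ⊎ a ≡ v
  joins-ends (inj₁ p) (inj₁ q) = inj₁ (cong proj₁ (trans (sym p) q))
  joins-ends (inj₁ p) (inj₂ q) = inj₂ (cong proj₁ (trans (sym p) q))
  joins-ends (inj₂ p) (inj₁ q) = inj₂ (cong proj₂ (trans (sym p) q))
  joins-ends (inj₂ p) (inj₂ q) = inj₁ (cong proj₂ (trans (sym p) q))

  infixr 5 _∷⟨_⟩_

  data Walk (A : Pred (Fin n) 0ℓ) : Fin n → Fin n → Set where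
    [_]    : ∀ {a} → A a → Walk A a a
    _∷⟨_⟩_ : ∀ {a b c e} → A a → Joins G e a b → Walk A b c → Walk A a c

  module _ {A : Pred (Fin n) 0ℓ} where

    first : ∀ {a b} → Walk A a b → A a
    first [ p ]          = p
    first (p ∷⟨ _ ⟩ _) = p

    _++_ : ∀ {a b c} → Walk A a b → Walk A b c → Walk A a c
    [ _ ]          ++ w′ = w′
    (p ∷⟨ j ⟩ w) ++ w′ = p ∷⟨ j ⟩ (w ++ w′)

    reverse : ∀ {a b} → Walk A a b → Walk A b a
    reverse [ p ]          = [ p ]
    reverse (p ∷⟨ j ⟩ w) = reverse w ++ (first w ∷⟨ joins-sym j ⟩ [ p ])

    length : ∀ {a b} → Walk A a b → ℕ
    length [ _ ]          = 0
    length (_ ∷⟨ _ ⟩ w) = suc (length w)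

    vertex : ∀ {a b} (w : Walk A a b) → Fin (suc (length w)) → Fin n
    vertex {a} w            zero    = a
    vertex (_ ∷⟨ _ ⟩ w) (suc i) = vertex w i

    edge : ∀ {a b} (w : Walk A a b) → Fin (length w) → Fin m
    edge (_∷⟨_⟩_ {e = e} _ _ _) zero    = e
    edge (_ ∷⟨ _ ⟩ w)           (suc i) = edge w i

    vertex∈ : ∀ {a b} (w : Walk A a b) i → A (vertex w i)
    vertex∈ w            zero    = first w
    vertex∈ (_ ∷⟨ _ ⟩ w) (suc i) = vertex∈ w i

    edge-joins : ∀ {a b} (w : Walk A a b) i → Joins G (edge w i) (vertex w (inject₁ i)) (vertex w (suc i))
    edge-joins (_ ∷⟨ j ⟩ w) zero    = j
    edge-joins (_ ∷⟨ _ ⟩ w) (suc i) = edge-joins w i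

    Simple : ∀ {a b} → Walk A a b → Set
    Simple [ _ ]              = ⊤
    Simple {a} (_ ∷⟨ _ ⟩ w) = (∀ i → vertex w i ≢ a) × Simple w

    vertex-injective : ∀ {a b} (w : Walk A a b) → Simple w → ∀ {i j} → vertex w i ≡ vertex w j → i ≡ j
    vertex-injective w            s              {zero}  {zero}  _  = refl
    vertex-injective (_ ∷⟨ _ ⟩ w) (fresh , _)    {zero}  {suc j} eq = contradiction (sym eq) (fresh j)
    vertex-injective (_ ∷⟨ _ ⟩ w) (fresh , _)    {suc i} {zero}  eq = contradiction eq (fresh i)
    vertex-injective (_ ∷⟨ _ ⟩ w) (_ , s)        {suc i} {suc j} eq = cong suc (vertex-injective w s eq)

    edge≢edge-at : ∀ {a y b c e} → Joins G e a y → (w : Walk A b c) → (∀ i → vertex w i ≢ a) →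
                   ∀ i → edge w i ≢ e
    edge≢edge-at j w fresh i refl with joins-ends j (edge-joins w i)
    ... | inj₁ eq = fresh (inject₁ i) (sym eq)
    ... | inj₂ eq = fresh (suc i) (sym eq)

    suffix : ∀ {a b} (w : Walk A a b) → Simple w → ∀ i → Σ (Walk A (vertex w i) b) Simple
    suffix w            s       zero    = w , s
    suffix (_ ∷⟨ _ ⟩ w) (_ , s) (suc i) = suffix w s i

    shortcut : ∀ {a b} → Walk A a b → Σ (Walk A a b) Simple
    shortcut [ p ] = [ p ] , tt
    shortcut {a} {b} (p ∷⟨ j ⟩ w) with shortcut w
    ... | w′ , s with any? (λ i → vertex w′ i ≟ a)
    ... | yes (i , eq) = subst (λ v → Σ (Walk A v b) Simple) eq (suffix w′ s i)
    ... | no a∉w′      = (p ∷⟨ j ⟩ w′) , (λ i eq → a∉w′ (i , eq)) , s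

  walk-map : ∀ {A B : Pred (Fin n) 0ℓ} → (∀ {v} → A v → B v) → ∀ {a b} → Walk A a b → Walk B a b
  walk-map f [ p ]          = [ f p ]
  walk-map f (p ∷⟨ j ⟩ w) = f p ∷⟨ j ⟩ walk-map f w

  -- The cycle x, y₁, …, y₂, x through a simple walk w from y₁ to y₂ inside C: outgoing w i is the cycle
  -- edge leaving the i-th vertex of w and successor w i its other end.
  module Ear {C : Subset n} {x y₁ y₂ : Fin n} {e₁ e₂ : Fin m} (x∉C : x ∉ C) (e₁≢e₂ : e₁ ≢ e₂)
             (j₁ : Joins G e₁ x y₁) (j₂ : Joins G e₂ x y₂) where

    successor : ∀ {a} (w : Walk (_∈ C) a y₂) → Fin (suc (length w)) → Fin n
    successor [ _ ]        zero    = x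
    successor (_ ∷⟨ _ ⟩ w) zero    = vertex w zero
    successor (_ ∷⟨ _ ⟩ w) (suc i) = successor w i

    outgoing : ∀ {a} (w : Walk (_∈ C) a y₂) → Fin (suc (length w)) → Fin m
    outgoing [ _ ]        zero    = e₂
    outgoing w@(_ ∷⟨ _ ⟩ _) zero  = edge w zero
    outgoing (_ ∷⟨ _ ⟩ w) (suc i) = outgoing w i

    outgoing-joins : ∀ {a} (w : Walk (_∈ C) a y₂) i → Joins G (outgoing w i) (vertex w i) (successor w i)
    outgoing-joins [ _ ]        zero    = joins-sym j₂
    outgoing-joins (_ ∷⟨ j ⟩ w) zero    = j
    outgoing-joins (_ ∷⟨ _ ⟩ w) (suc i) = outgoing-joins w i

    outgoing-cases : ∀ {a} (w : Walk (_∈ C) a y₂) i → outgoing w i ≡ e₂ ⊎ ∃ λ k → outgoing w i ≡ edge w k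
    outgoing-cases [ _ ]        zero    = inj₁ refl
    outgoing-cases (_ ∷⟨ _ ⟩ w) zero    = inj₂ (zero , refl)
    outgoing-cases (_ ∷⟨ _ ⟩ w) (suc i) with outgoing-cases w i
    ... | inj₁ eq       = inj₁ eq
    ... | inj₂ (k , eq) = inj₂ (suc k , eq)

    x∉walk : ∀ {a b} (w : Walk (_∈ C) a b) i → vertex w i ≢ x
    x∉walk w i eq = x∉C (subst (_∈ C) eq (vertex∈ w i))

    e₁≢outgoing : ∀ {a} (w : Walk (_∈ C) a y₂) i → e₁ ≢ outgoing w i
    e₁≢outgoing w i eq with outgoing-cases w i
    ... | inj₁ eq₂       = e₁≢e₂ (trans eq eq₂)
    ... | inj₂ (k , eqₖ) = edge≢edge-at j₁ w (x∉walk w) k (sym (trans eq eqₖ))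

    outgoing-injective : ∀ {a} (w : Walk (_∈ C) a y₂) → Simple w →
                         ∀ {i i′} → outgoing w i ≡ outgoing w i′ → i ≡ i′
    outgoing-injective w s {zero} {zero} _ = refl
    outgoing-injective w@(_ ∷⟨ j ⟩ w′) (fresh , _) {zero} {suc i′} eq with outgoing-cases w′ i′
    ... | inj₁ eq₂       = contradiction (trans eq eq₂) (edge≢edge-at j₂ w (x∉walk w) zero)
    ... | inj₂ (k , eqₖ) = contradiction (sym (trans eq eqₖ)) (edge≢edge-at j w′ fresh k)
    outgoing-injective w@(_ ∷⟨ j ⟩ w′) (fresh , _) {suc i} {zero} eq with outgoing-cases w′ i
    ... | inj₁ eq₂       = contradiction (trans (sym eq) eq₂) (edge≢edge-at j₂ w (x∉walk w) zero)
    ... | inj₂ (k , eqₖ) = contradiction (trans (sym eqₖ) eq) (edge≢edge-at j w′ fresh k)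
    outgoing-injective (_ ∷⟨ _ ⟩ w) (_ , s) {suc i} {suc i′} eq = cong suc (outgoing-injective w s eq)

    cycle-vertex : ∀ {a} (w : Walk (_∈ C) a y₂) → Fin (suc (suc (length w))) → Fin n
    cycle-vertex w zero    = x
    cycle-vertex w (suc i) = vertex w i

    cycle-vertex-csuc : ∀ {a} (w : Walk (_∈ C) a y₂) i → cycle-vertex w (csuc (suc i)) ≡ successor w i
    cycle-vertex-csuc [ _ ]        zero    = refl
    cycle-vertex-csuc (_ ∷⟨ _ ⟩ w) zero    = refl
    cycle-vertex-csuc (_ ∷⟨ _ ⟩ w) (suc i) with csuc (suc i) | cycle-vertex-csuc w i
    ... | zero  | eq = eq
    ... | suc _ | eq = eq

    close : (w : Walk (_∈ C) y₁ y₂) → Simple w → Cycle G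
    close w s = record
      { k         = suc (length w)
      ; verts     = cycle-vertex w
      ; edges     = cycle-edge
      ; verts-inj = verts-inj
      ; edges-inj = edges-inj
      ; joins     = joins
      }
      where
      cycle-edge : Fin (suc (suc (length w))) → Fin m
      cycle-edge zero    = e₁
      cycle-edge (suc i) = outgoing w i
      verts-inj : ∀ {i i′} → cycle-vertex w i ≡ cycle-vertex w i′ → i ≡ i′
      verts-inj {zero}  {zero}   _  = refl
      verts-inj {zero}  {suc i′} eq = contradiction (sym eq) (x∉walk w i′)
      verts-inj {suc i} {zero}   eq = contradiction eq (x∉walk w i)
      verts-inj {suc i} {suc i′} eq = cong suc (vertex-injective w s eq)
      edges-inj : ∀ {i i′} → cycle-edge i ≡ cycle-edge i′ → i ≡ i′
      edges-inj {zero}  {zero}   _  = refl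
      edges-inj {zero}  {suc i′} eq = contradiction eq (e₁≢outgoing w i′)
      edges-inj {suc i} {zero}   eq = contradiction (sym eq) (e₁≢outgoing w i)
      edges-inj {suc i} {suc i′} eq = cong suc (outgoing-injective w s eq)
      joins : ∀ i → Joins G (cycle-edge i) (cycle-vertex w i) (cycle-vertex w (csuc i))
      joins zero    = j₁
      joins (suc i) = subst (Joins G (outgoing w i) (vertex w i)) (sym (cycle-vertex-csuc w i)) (outgoing-joins w i)

    close-only-outside : (w : Walk (_∈ C) y₁ y₂) (s : Simple w) → OnlyOutside G (close w s) C x
    close-only-outside w s = (zero , refl) , x∉C , outside
      where
      outside : ∀ i → cycle-vertex w i ∉ C → cycle-vertex w i ≡ x
      outside zero    _   = refl
      outside (suc i) ∉C = contradiction (vertex∈ w i) ∉C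

  convex-absorbs-ear : ∀ {C} → Convex G C → ∀ {x y₁ y₂ e₁ e₂} → e₁ ≢ e₂ →
                       Joins G e₁ x y₁ → Joins G e₂ x y₂ → Walk (_∈ C) y₁ y₂ → x ∈ C
  convex-absorbs-ear {C} convex {x} e₁≢e₂ j₁ j₂ w with x ∈? C
  ... | yes x∈C = x∈C
  ... | no x∉C  with shortcut w
  ...   | w′ , s = convex (Ear.close x∉C e₁≢e₂ j₁ j₂ w′ s) x (Ear.close-only-outside x∉C e₁≢e₂ j₁ j₂ w′ s)

-- The greedy construction

-- s, p, ∂, o: sizes of S and P, boundary and open labels before a step (primed: after it); b and j: back
-- edges and touched labels of the new vertex; c: open labels it may create; d: vertices it adds to S.
potential-step : ∀ {s p ∂ ∂′ o o′ b c j} d →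
                 4 * s + 2 * o ≤ 2 * p + ∂ → ∂ + 4 ≡ ∂′ + 2 * b → o′ + j ≤ o + c → 2 * d + b + c ≤ 3 + j →
                 4 * (d + s) + 2 * o′ ≤ 2 * suc p + ∂′
potential-step {s} {p} {∂} {∂′} {o} {o′} {b} {c} {j} d inv balance merge budget =
  +-cancelʳ-≤ (2 * b + 2 * j) _ _ (begin
    4 * (d + s) + 2 * o′ + (2 * b + 2 * j)       ≡⟨ solve (d ∷ s ∷ o′ ∷ b ∷ j ∷ []) ⟩
    4 * s + 2 * (o′ + j) + 2 * (2 * d + b)       ≤⟨ +-monoˡ-≤ _ (+-monoʳ-≤ (4 * s) (*-monoʳ-≤ 2 merge)) ⟩
    4 * s + 2 * (o + c) + 2 * (2 * d + b)        ≡⟨ solve (s ∷ o ∷ c ∷ d ∷ b ∷ []) ⟩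
    (4 * s + 2 * o) + 2 * (2 * d + b + c)        ≤⟨ +-mono-≤ inv (*-monoʳ-≤ 2 budget) ⟩
    (2 * p + ∂) + 2 * (3 + j)                    ≡⟨ solve (p ∷ ∂ ∷ j ∷ []) ⟩
    2 * suc p + (∂ + 4) + 2 * j                  ≡⟨ cong (λ t → 2 * suc p + t + 2 * j) balance ⟩
    2 * suc p + (∂′ + 2 * b) + 2 * j             ≡⟨ solve (p ∷ ∂′ ∷ b ∷ j ∷ []) ⟩
    2 * suc p + ∂′ + (2 * b + 2 * j)             ∎)
  where open ≤-Reasoning

module Greedy {n m : ℕ} (G : Graph n m) where
  open Walks G

  src tgt : Fin m → Fin n
  src e = proj₁ (G e)
  tgt e = proj₂ (G e)

  Incident : Fin n → Fin m → Set
  Incident x e = src e ≡ x ⊎ tgt e ≡ x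

  incident? : ∀ x e → Dec (Incident x e)
  incident? x e = src e ≟ x ⊎-dec tgt e ≟ x

  other : Fin n → Fin m → Fin n
  other x e = if does (src e ≟ x) then tgt e else src e

  touches : Fin n → Fin m → ℕ
  touches x e = 𝟙 (src e ≟ x) + 𝟙 (tgt e ≟ x)

  module _ {x : Fin n} {e : Fin m} where

    other-src : src e ≡ x → other x e ≡ tgt e
    other-src s≡x = cong (if_then tgt e else src e) (dec-true (src e ≟ x) s≡x)

    incident⇒joins : Incident x e → Joins G e x (other x e)
    incident⇒joins i with src e ≟ x | i
    ... | yes s≡x | _        = inj₁ (cong (_, tgt e) s≡x)
    ... | no s≢x  | inj₁ s≡x = contradiction s≡x s≢x
    ... | no s≢x  | inj₂ t≡x = inj₂ (cong (src e ,_) t≡x)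

    xor-ends : Incident x e → ∀ (Q : Fin n → Bool) → Q (src e) xor Q (tgt e) ≡ Q x xor Q (other x e)
    xor-ends i Q with src e ≟ x | i
    ... | yes s≡x | _        = cong (λ v → Q v xor Q (tgt e)) s≡x
    ... | no s≢x  | inj₁ s≡x = contradiction s≡x s≢x
    ... | no s≢x  | inj₂ t≡x = trans (xor-comm (Q (src e)) (Q (tgt e))) (cong (λ v → Q v xor Q (src e)) t≡x)

    touches-incident : src e ≢ tgt e → Incident x e → touches x e ≡ 1
    touches-incident no-loop (inj₁ s≡x) =
      cong₂ _+_ (𝟙-yes (src e ≟ x) s≡x) (𝟙-no (tgt e ≟ x) λ t≡x → no-loop (trans s≡x (sym t≡x)))
    touches-incident no-loop (inj₂ t≡x) =
      cong₂ _+_ (𝟙-no (src e ≟ x) λ s≡x → no-loop (trans s≡x (sym t≡x))) (𝟙-yes (tgt e ≟ x) t≡x)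

    other≢ : src e ≢ tgt e → other x e ≢ x
    other≢ no-loop with src e ≟ x
    ... | yes s≡x = λ t≡x → no-loop (trans s≡x (sym t≡x))
    ... | no s≢x  = s≢x

  joins⇒incident : ∀ {e a b} → Joins G e a b → Incident a e
  joins⇒incident (inj₁ eq) = inj₁ (cong proj₁ eq)
  joins⇒incident (inj₂ eq) = inj₂ (cong proj₂ eq)

  joins⇒other : ∀ {e a b} → Joins G e a b → other a e ≡ b
  joins⇒other {e} {a} (inj₁ eq) = trans (other-src (cong proj₁ eq)) (cong proj₂ eq)
  joins⇒other {e} {a} (inj₂ eq) with src e ≟ a
  ... | yes s≡a = trans (cong proj₂ eq) (trans (sym s≡a) (cong proj₁ eq))
  ... | no s≢a  = cong proj₁ eq

  BackEdge : (Fin n → Bool) → Fin n → Fin m → Set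
  BackEdge P x e = Incident x e × T (P (other x e))

  back? : ∀ P x e → Dec (BackEdge P x e)
  back? P x e = incident? x e ×-dec T? (P (other x e))

  backDegree : (Fin n → Bool) → Fin n → ℕ
  backDegree P x = count (back? P x)

  ForwardEdge : (Fin n → Bool) → Fin n → Fin m → Set
  ForwardEdge P v e = Incident v e × ¬ T (P (other v e))

  HasForward : (Fin n → Bool) → Fin n → Set
  HasForward P v = ∃ (ForwardEdge P v)

  hasForward? : ∀ P v → Dec (HasForward P v)
  hasForward? P v = any? λ e → incident? v e ×-dec ¬? (T? (P (other v e)))

  crossing? : ∀ (P : Fin n → Bool) e → Dec (T (P (src e) xor P (tgt e)))
  crossing? P e = T? (P (src e) xor P (tgt e))

  boundary : (Fin n → Bool) → ℕ
  boundary P = count (crossing? P)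

  module _ {P P′ : Fin n → Bool} {x : Fin n} (ins : Insertion P x P′) (loopless : Loopless G) where
    open Insertion ins

    private
      balance : ∀ e → 𝟙 (crossing? P e) + touches x e ≡ 𝟙 (crossing? P′ e) + 2 * 𝟙 (back? P x e)
      balance e with incident? x e
      ... | yes i = begin
        𝟙 (crossing? P e) + touches x e
          ≡⟨ cong₂ _+_ (cong (𝟙 ∘ T?) (xor-ends i P)) (touches-incident (loopless e) i) ⟩
        𝟙 (T? (P x xor p)) + 1
          ≡⟨ cong (λ b → 𝟙 (T? (b xor p)) + 1) fresh ⟩
        𝟙 (T? p) + 1
          ≡⟨ flip-one p ⟩
        𝟙 (T? (true xor p)) + 2 * 𝟙 (T? p)
          ≡⟨ cong₂ (λ b c → 𝟙 (T? (b xor c)) + 2 * 𝟙 (T? p)) (sym added) (sym (unchanged (other≢ (loopless e)))) ⟩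
        𝟙 (T? (P′ x xor P′ (other x e))) + 2 * 𝟙 (T? p)
          ≡⟨ cong₂ (λ b c → 𝟙 (T? b) + 2 * c) (sym (xor-ends i P′)) (sym back≡p) ⟩
        𝟙 (crossing? P′ e) + 2 * 𝟙 (back? P x e) ∎
        where
        open ≡-Reasoning
        p : Bool
        p = P (other x e)
        back≡p : 𝟙 (back? P x e) ≡ 𝟙 (T? p)
        back≡p = cong (λ b → 𝟙 (T? (b ∧ p))) (dec-true (incident? x e) i)
        flip-one : ∀ b → 𝟙 (T? b) + 1 ≡ 𝟙 (T? (true xor b)) + 2 * 𝟙 (T? b)
        flip-one true  = refl
        flip-one false = refl
      ... | no ¬i = cong₂ _+_ (cong (𝟙 ∘ T?) (sym same-ends)) (trans untouched (sym (cong (2 *_) no-back)))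
        where
        same-ends : P′ (src e) xor P′ (tgt e) ≡ P (src e) xor P (tgt e)
        same-ends = cong₂ _xor_ (unchanged (¬i ∘ inj₁)) (unchanged (¬i ∘ inj₂))
        untouched : touches x e ≡ 0
        untouched = cong₂ _+_ (𝟙-no (src e ≟ x) (¬i ∘ inj₁)) (𝟙-no (tgt e ≟ x) (¬i ∘ inj₂))
        no-back : 𝟙 (back? P x e) ≡ 0
        no-back = 𝟙-no (back? P x e) (¬i ∘ proj₁)

    boundary-insertion : boundary P + sum (touches x) ≡ boundary P′ + 2 * backDegree P x
    boundary-insertion = begin
      boundary P + sum (touches x)                         ≡⟨ ∑-distrib-+ (𝟙 ∘ crossing? P) (touches x) ⟨
      sum (λ e → 𝟙 (crossing? P e) + touches x e)          ≡⟨ sum-cong-≗ balance ⟩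
      sum (λ e → 𝟙 (crossing? P′ e) + 2 * 𝟙 (back? P x e)) ≡⟨ ∑-distrib-+ (𝟙 ∘ crossing? P′) _ ⟩
      boundary P′ + sum (λ e → 2 * 𝟙 (back? P x e))        ≡⟨ cong (boundary P′ +_) (*-distribˡ-sum 2 (𝟙 ∘ back? P x)) ⟨
      boundary P′ + 2 * backDegree P x                      ∎
      where open ≡-Reasoning

  degree≡sum-touches : ∀ x → degree G x ≡ sum (touches x)
  degree≡sum-touches x = begin
    degree G x                                   ≡⟨ cong ListSum.sum (List.map-tabulate id ends) ⟩
    ListSum.sum (List.tabulate ends)             ≡⟨ sum-tabulate ends ⟩
    sum ends                                     ≡⟨ sum-cong-≗ (λ e → cong₂ _+_ (isYes≗𝟙 (src e ≟ x)) (isYes≗𝟙 (tgt e ≟ x))) ⟩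
    sum (touches x)                              ∎
    where
    open ≡-Reasoning
    ends : Fin m → ℕ
    ends e = (if isYes (src e ≟ x) then 1 else 0) + (if isYes (tgt e ≟ x) then 1 else 0)
    isYes≗𝟙 : ∀ {a} {A : Set a} (a? : Dec A) → (if isYes a? then 1 else 0) ≡ 𝟙 a?
    isYes≗𝟙 (yes _) = refl
    isYes≗𝟙 (no _)  = refl
    sum-tabulate : ∀ {k} (f : Fin k → ℕ) → ListSum.sum (List.tabulate f) ≡ sum f
    sum-tabulate {zero}  f = refl
    sum-tabulate {suc k} f = cong (f zero +_) (sum-tabulate (f ∘ suc))

  back≤touches : ∀ P x e → 𝟙 (back? P x e) ≤ touches x e
  back≤touches P x e = ≤-trans (𝟙-mono proj₁ (back? P x e) (incident? x e)) (𝟙-⊎ (src e ≟ x) (tgt e ≟ x))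

  module _ (regular : FourRegular G) where

    sum-touches : ∀ x → sum (touches x) ≡ 4
    sum-touches x = trans (sym (degree≡sum-touches x)) (regular x)

    backDegree≤4 : ∀ P x → backDegree P x ≤ 4
    backDegree≤4 P x = ≤-trans (sum-mono-≤ (back≤touches P x)) (≤-reflexive (sum-touches x))

    backDegree<4 : ∀ {P P′ x} → Insertion P x P′ → HasForward P′ x → backDegree P x + 1 ≤ 4
    backDegree<4 {P} {P′} {x} ins (e₀ , i₀ , out₀) = begin
      backDegree P x + 1                                ≡⟨ cong (backDegree P x +_) (count-singleton e₀) ⟨
      backDegree P x + count (_≟ e₀)                    ≡⟨ ∑-distrib-+ (𝟙 ∘ back? P x) (𝟙 ∘ (_≟ e₀)) ⟨
      sum (λ e → 𝟙 (back? P x e) + 𝟙 (e ≟ e₀))          ≤⟨ sum-mono-≤ pointwise ⟩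
      sum (touches x)                                   ≡⟨ sum-touches x ⟩
      4                                                 ∎
      where
      open ≤-Reasoning
      pointwise : ∀ e → 𝟙 (back? P x e) + 𝟙 (e ≟ e₀) ≤ touches x e
      pointwise e with e ≟ e₀
      ... | no _     = ≤-trans (≤-reflexive (+-identityʳ _)) (back≤touches P x e)
      ... | yes refl = ≤-trans (≤-reflexive (cong (_+ 1) (𝟙-no (back? P x e) (out₀ ∘ Insertion.old⇒new ins ∘ proj₂))))
                               (≤-trans (≤-reflexive (sym (𝟙-yes (incident? x e) i₀))) (𝟙-⊎ (src e ≟ x) (tgt e ≟ x)))

  Open : (Fin n → Bool) → (Fin n → Fin n) → Fin n → Set
  Open P L ℓ = ∃ λ v → T (P v) × L v ≡ ℓ × HasForward P v

  open? : ∀ P L ℓ → Dec (Open P L ℓ)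
  open? P L ℓ = any? λ v → T? (P v) ×-dec L v ≟ ℓ ×-dec hasForward? P v

  openLabels : (Fin n → Bool) → (Fin n → Fin n) → ℕ
  openLabels P L = count (open? P L)

  record Labelling (P : Fin n → Bool) : Set where
    field
      label   : Fin n → Fin n
      label∈P : ∀ {v} → T (P v) → T (P (label v))
      connect : ∀ {a b} → T (P a) → T (P b) → label a ≡ label b → Walk (T ∘ P) a b

  module Merge {P P′ : Fin n → Bool} {x : Fin n} (ins : Insertion P x P′) (lab : Labelling P) where
    open Insertion ins
    open Labelling lab

    Touched : Fin n → Set
    Touched ℓ = ∃ λ e → BackEdge P x e × label (other x e) ≡ ℓ

    touched? : ∀ ℓ → Dec (Touched ℓ)
    touched? ℓ = any? λ e → back? P x e ×-dec label (other x e) ≟ ℓ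

    touchedLabels : ℕ
    touchedLabels = count touched?

    Merged : Fin n → Set
    Merged v = v ≡ x ⊎ Touched (label v)

    merged? : ∀ v → Dec (Merged v)
    merged? v = v ≟ x ⊎-dec touched? (label v)

    label′ : Fin n → Fin n
    label′ v = if does (merged? v) then x else label v

    label′-merged : ∀ {v} → Merged v → label′ v ≡ x
    label′-merged {v} m = cong (if_then x else label v) (dec-true (merged? v) m)

    label′-kept : ∀ {v} → ¬ Merged v → label′ v ≡ label v
    label′-kept {v} ¬m = cong (if_then x else label v) (dec-false (merged? v) ¬m)

    label≢x : ∀ {v} → T (P v) → label v ≢ x
    label≢x p eq = x∉P (subst (T ∘ P) eq (label∈P p))

    touched≢x : ∀ {ℓ} → Touched ℓ → ℓ ≢ x
    touched≢x (e , (_ , p) , refl) = label≢x p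

    touched⇒open : ∀ {ℓ} → Touched ℓ → Open P label ℓ
    touched⇒open (e , (i , p) , eq) =
      other x e , p , eq , e , joins⇒incident back , subst (λ v → ¬ T (P v)) (sym (joins⇒other back)) x∉P
      where
      back : Joins G e (other x e) x
      back = joins-sym (incident⇒joins i)

    touched⇒¬open′ : ∀ {ℓ} → Touched ℓ → ¬ Open P′ label′ ℓ
    touched⇒¬open′ t (v , _ , eq , _) with merged? v
    ... | yes m  = touched≢x t (trans (sym eq) (label′-merged m))
    ... | no ¬m  = ¬m (inj₂ (subst Touched (sym (trans (sym (label′-kept ¬m)) eq)) t))

    open′⇒open : ∀ {ℓ} → ℓ ≢ x → ¬ Touched ℓ → Open P′ label′ ℓ → Open P label ℓ
    open′⇒open ℓ≢x ¬t (v , p′ , eq , e , i , out) with merged? v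
    ... | yes m  = contradiction (trans (sym eq) (label′-merged m)) ℓ≢x
    ... | no ¬m  = v , new⇒old v≢x p′ , trans (sym (label′-kept ¬m)) eq , e , i , out ∘ old⇒new
      where
      v≢x : v ≢ x
      v≢x = ¬m ∘ inj₁

    openLabels-merge : openLabels P′ label′ + touchedLabels ≤ openLabels P label + 1
    openLabels-merge = begin
      openLabels P′ label′ + touchedLabels               ≡⟨ ∑-distrib-+ (𝟙 ∘ open? P′ label′) (𝟙 ∘ touched?) ⟨
      sum (λ ℓ → 𝟙 (open? P′ label′ ℓ) + 𝟙 (touched? ℓ))  ≤⟨ sum-mono-≤ pointwise ⟩
      sum (λ ℓ → 𝟙 (open? P label ℓ) + 𝟙 (ℓ ≟ x))         ≡⟨ ∑-distrib-+ (𝟙 ∘ open? P label) (𝟙 ∘ (_≟ x)) ⟩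
      openLabels P label + count (_≟ x)                  ≡⟨ cong (openLabels P label +_) (count-singleton x) ⟩
      openLabels P label + 1                             ∎
      where
      open ≤-Reasoning
      pointwise : ∀ ℓ → 𝟙 (open? P′ label′ ℓ) + 𝟙 (touched? ℓ) ≤ 𝟙 (open? P label ℓ) + 𝟙 (ℓ ≟ x)
      pointwise ℓ with touched? ℓ | ℓ ≟ x
      ... | yes t  | _       = ≤-trans (≤-reflexive (cong (_+ 1) (𝟙-no (open? P′ label′ ℓ) (touched⇒¬open′ t))))
                                       (≤-trans (≤-reflexive (sym (𝟙-yes (open? P label ℓ) (touched⇒open t)))) (m≤m+n _ _))
      ... | no _   | yes _   = ≤-trans (≤-reflexive (+-identityʳ _)) (≤-trans (𝟙≤1 (open? P′ label′ ℓ)) (m≤n+m 1 _))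
      ... | no ¬t  | no ℓ≢x  = +-mono-≤ (𝟙-mono (open′⇒open ℓ≢x ¬t) (open? P′ label′ ℓ) (open? P label ℓ)) z≤n

    openLabels-merge-closed : (∀ {v} → T (P′ v) → ¬ HasForward P′ v) →
                              openLabels P′ label′ + touchedLabels ≤ openLabels P label
    openLabels-merge-closed closed = begin
      openLabels P′ label′ + touchedLabels
        ≡⟨ cong (_+ touchedLabels) (count-empty (open? P′ label′) λ ℓ (v , p′ , _ , f) → closed p′ f) ⟩
      touchedLabels
        ≤⟨ count-mono touched? (open? P label) touched⇒open ⟩
      openLabels P label ∎
      where open ≤-Reasoning

    walk-from-x : ∀ {a} → T (P′ a) → Merged a → Walk (T ∘ P′) x a
    walk-from-x {a} p′ m with a ≟ x | m
    ... | yes refl | _                         = [ p′ ]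
    ... | no a≢x   | inj₁ a≡x                  = contradiction a≡x a≢x
    ... | no a≢x   | inj₂ (e , (i , p) , eq)   =
      x∈P′ ∷⟨ incident⇒joins i ⟩ walk-map old⇒new (connect p (new⇒old a≢x p′) eq)

    labelling′ : Labelling P′
    labelling′ = record { label = label′ ; label∈P = label′∈P′ ; connect = connect′ }
      where
      label′∈P′ : ∀ {v} → T (P′ v) → T (P′ (label′ v))
      label′∈P′ {v} p′ with merged? v
      ... | yes m = subst (T ∘ P′) (sym (label′-merged m)) x∈P′
      ... | no ¬m = subst (T ∘ P′) (sym (label′-kept ¬m)) (old⇒new (label∈P (new⇒old (¬m ∘ inj₁) p′)))
      connect′ : ∀ {a b} → T (P′ a) → T (P′ b) → label′ a ≡ label′ b → Walk (T ∘ P′) a b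
      connect′ {a} {b} pa pb eq with merged? a | merged? b
      ... | yes ma | yes mb = reverse (walk-from-x pa ma) ++ walk-from-x pb mb
      ... | yes ma | no ¬mb = contradiction (trans (sym (label′-merged ma)) (trans eq (label′-kept ¬mb)))
                                            (label≢x (new⇒old (¬mb ∘ inj₁) pb) ∘ sym)
      ... | no ¬ma | yes mb = contradiction (trans (sym (label′-kept ¬ma)) (trans eq (label′-merged mb)))
                                            (label≢x (new⇒old (¬ma ∘ inj₁) pa))
      ... | no ¬ma | no ¬mb = walk-map old⇒new (connect (new⇒old (¬ma ∘ inj₁) pa) (new⇒old (¬mb ∘ inj₁) pb)
                                                       (trans (sym (label′-kept ¬ma)) (trans eq (label′-kept ¬mb))))

    Duplicate : Set
    Duplicate = ∃₂ λ e₁ e₂ →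
      e₁ ≢ e₂ × BackEdge P x e₁ × BackEdge P x e₂ × label (other x e₁) ≡ label (other x e₂)

    duplicate? : Dec Duplicate
    duplicate? = any? λ e₁ → any? λ e₂ →
      ¬? (e₁ ≟ e₂) ×-dec back? P x e₁ ×-dec back? P x e₂ ×-dec label (other x e₁) ≟ label (other x e₂)

    duplicate⇒touched : Duplicate → 1 ≤ touchedLabels
    duplicate⇒touched (e₁ , _ , _ , b₁ , _) = count-pos touched? (e₁ , b₁ , refl)

    backDegree≤touchedLabels : ¬ Duplicate → backDegree P x ≤ touchedLabels
    backDegree≤touchedLabels ¬dup =
      count-injection (back? P x) touched? (label ∘ other x) (λ b → _ , b , refl) injective
      where
      injective : ∀ {e₁ e₂} → BackEdge P x e₁ → BackEdge P x e₂ →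
                  label (other x e₁) ≡ label (other x e₂) → e₁ ≡ e₂
      injective {e₁} {e₂} b₁ b₂ eq with e₁ ≟ e₂
      ... | yes e₁≡e₂ = e₁≡e₂
      ... | no e₁≢e₂  = contradiction (e₁ , e₂ , e₁≢e₂ , b₁ , b₂ , eq) ¬dup

    duplicate⇒x∈convex : Duplicate → ∀ {C} → Convex G C → (∀ {v} → T (P v) → v ∈ C) → x ∈ C
    duplicate⇒x∈convex (e₁ , e₂ , e₁≢e₂ , (i₁ , p₁) , (i₂ , p₂) , eq) convex P⊆C =
      convex-absorbs-ear convex e₁≢e₂ (incident⇒joins i₁) (incident⇒joins i₂) (walk-map P⊆C (connect p₁ p₂ eq))

  AdmissibleLast : (Fin n → Bool) → Fin n → Set
  AdmissibleLast P x = HasForward P x ⊎ (∀ {v} → T (P v) → ¬ HasForward P v)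

  record Progress (P : Fin n → Bool) : Set where
    field
      S         : Fin n → Bool
      labelling : Labelling P
      S⊆P       : ∀ {v} → T (S v) → T (P v)
      P⊆hull    : ∀ {C} → Convex G C → (∀ {v} → T (S v) → v ∈ C) → ∀ {v} → T (P v) → v ∈ C
      potential : 4 * size S + 2 * openLabels P (Labelling.label labelling) ≤ 2 * size P + boundary P

  module _ (loopless : Loopless G) (regular : FourRegular G) where

    module Step {P P′ x} (ins : Insertion P x P′) (admissible : AdmissibleLast P′ x) (progress : Progress P)
                where
      open Insertion ins
      open Progress progress
      open Labelling labelling
      open Merge ins labelling

      record Budget : Set where
        field
          opened : ℕ
          opened≤1 : opened ≤ 1
          merge : openLabels P′ label′ + touchedLabels ≤ openLabels P label + opened
          back+opened≤4 : backDegree P x + opened ≤ 4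

      budget : AdmissibleLast P′ x → Budget
      budget (inj₁ forward) = record
        { opened = 1 ; opened≤1 = ≤-refl ; merge = openLabels-merge
        ; back+opened≤4 = backDegree<4 regular ins forward
        }
      budget (inj₂ closed)  = record
        { opened = 0 ; opened≤1 = z≤n
        ; merge = ≤-trans (openLabels-merge-closed closed) (≤-reflexive (sym (+-identityʳ _)))
        ; back+opened≤4 = ≤-trans (≤-reflexive (+-identityʳ _)) (backDegree≤4 regular P x)
        }

      open Budget (budget admissible)

      potential′ : ∀ d → 2 * d + backDegree P x + opened ≤ 3 + touchedLabels →
                   4 * (d + size S) + 2 * openLabels P′ label′ ≤ 2 * size P′ + boundary P′
      potential′ d affordable =
        subst (λ p → 4 * (d + size S) + 2 * openLabels P′ label′ ≤ 2 * p + boundary P′) (sym size-insertion)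
              (potential-step {s = size S} {p = size P} d potential balance merge affordable)
        where
        balance : boundary P + 4 ≡ boundary P′ + 2 * backDegree P x
        balance = trans (cong (boundary P +_) (sym (sum-touches regular x))) (boundary-insertion ins loopless)

      forced : Duplicate → Progress P′
      forced dup = record
        { S         = S
        ; labelling = labelling′
        ; S⊆P       = old⇒new ∘ S⊆P
        ; P⊆hull    = P′⊆hull
        ; potential = potential′ 0 affordable
        }
        where
        affordable : backDegree P x + opened ≤ 3 + touchedLabels
        affordable = ≤-trans back+opened≤4 (+-monoʳ-≤ 3 (duplicate⇒touched dup))
        P′⊆hull : ∀ {C} → Convex G C → (∀ {v} → T (S v) → v ∈ C) → ∀ {v} → T (P′ v) → v ∈ C
        P′⊆hull convex S⊆C {v} p′ with v ≟ x
        ... | yes refl = duplicate⇒x∈convex dup convex (P⊆hull convex S⊆C)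
        ... | no v≢x   = P⊆hull convex S⊆C (new⇒old v≢x p′)

      free : ¬ Duplicate → Progress P′
      free ¬dup = record
        { S         = insert x S
        ; labelling = labelling′
        ; S⊆P       = S′⊆P′
        ; P⊆hull    = P′⊆hull
        ; potential = subst (λ s → 4 * s + 2 * openLabels P′ label′ ≤ 2 * size P′ + boundary P′)
                            (sym (Insertion.size-insertion S-ins)) (potential′ 1 affordable)
        }
        where
        affordable : 2 + backDegree P x + opened ≤ 3 + touchedLabels
        affordable = ≤-trans (+-mono-≤ (+-monoʳ-≤ 2 (backDegree≤touchedLabels ¬dup)) opened≤1)
                             (≤-reflexive (+-comm (2 + touchedLabels) 1))
        S-ins : Insertion S x (insert x S)
        S-ins = insertion-insert (x∉P ∘ S⊆P)
        S′⊆P′ : ∀ {v} → T (insert x S v) → T (P′ v)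
        S′⊆P′ {v} s′ with v ≟ x
        ... | yes refl = x∈P′
        ... | no v≢x   = old⇒new (S⊆P s′)
        P′⊆hull : ∀ {C} → Convex G C → (∀ {v} → T (insert x S v) → v ∈ C) → ∀ {v} → T (P′ v) → v ∈ C
        P′⊆hull convex S′⊆C {v} p′ with v ≟ x
        ... | yes refl = S′⊆C (Insertion.x∈P′ S-ins)
        ... | no v≢x   = P⊆hull convex (S′⊆C ∘ Insertion.old⇒new S-ins) (new⇒old v≢x p′)

    progress-step : ∀ {P P′ x} → Insertion P x P′ → AdmissibleLast P′ x → Progress P → Progress P′
    progress-step ins admissible progress with Merge.duplicate? ins (Progress.labelling progress)
    ... | yes dup  = Step.forced ins admissible progress dup
    ... | no ¬dup  = Step.free ins admissible progress ¬dup

    admissible-last-vertex : ∀ Q {k} → size Q ≡ suc k → ∃ λ x → T (Q x) × AdmissibleLast Q x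
    admissible-last-vertex Q nonempty with any? (λ v → T? (Q v) ×-dec hasForward? Q v)
    ... | yes (x , x∈Q , forward) = x , x∈Q , inj₁ forward
    ... | no ¬forward with any? (T? ∘ Q)
    ...   | yes (x , x∈Q) = x , x∈Q , inj₂ λ q f → ¬forward (_ , q , f)
    ...   | no ¬any       = contradiction (trans (sym (count-empty (T? ∘ Q) λ v q → ¬any (v , q))) nonempty) λ ()

    initial : ∀ Q → size Q ≡ 0 → Progress Q
    initial Q size≡0 = record
      { S         = λ _ → false
      ; labelling = record { label = id ; label∈P = ∉Q ; connect = λ q → ∉Q q }
      ; S⊆P       = λ ()
      ; P⊆hull    = λ _ _ q → ∉Q q
      ; potential = ≤-trans (≤-reflexive (cong₂ (λ s o → 4 * s + 2 * o) no-S no-open)) z≤n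
      }
      where
      ∉Q : ∀ {A : Set} {v} → T (Q v) → A
      ∉Q {v = v} q = contradiction (≤-trans (count-pos (T? ∘ Q) q) (≤-reflexive size≡0)) λ ()
      no-S : size {n} (λ _ → false) ≡ 0
      no-S = count-empty {n} (λ _ → T? false) λ _ ()
      no-open : openLabels Q id ≡ 0
      no-open = count-empty (open? Q id) λ _ (_ , q , _) → ∉Q q

    progress : ∀ k Q → size Q ≡ k → Progress Q
    progress zero    Q size≡0 = initial Q size≡0
    progress (suc k) Q size≡  with admissible-last-vertex Q size≡
    ... | x , x∈Q , admissible =
      progress-step ins admissible (progress k (remove x Q) (ℕ.suc-injective (trans (sym size-insertion) size≡)))
      where
      ins : Insertion (remove x Q) x Q
      ins = insertion-remove x∈Q
      open Insertion ins using (size-insertion)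

hull-number-bound : ∀ {n m} (G : Graph n m) → Loopless G → FourRegular G → ∃ λ S → HullSet G S × 2 * ∣ S ∣ ≤ n
hull-number-bound {n} G loopless regular =
  tabulate S , hull , subst (λ s → 2 * s ≤ n) (sym (∣tabulate∣≡size S)) bound
  where
  open Greedy G
  full : Fin n → Bool
  full _ = true
  open Progress (progress loopless regular n full size-full)
  hull : HullSet G (tabulate S)
  hull C S⊆C convex v = P⊆hull convex (S⊆C ∘ ∈-tabulate S) {v} _
  bound : 2 * size S ≤ n
  bound = ℕ.*-cancelˡ-≤ 2 (begin
    2 * (2 * size S)                                          ≡⟨ ℕ.*-assoc 2 2 (size S) ⟨
    4 * size S                                                ≤⟨ m≤m+n _ _ ⟩
    4 * size S + 2 * openLabels full (Labelling.label labelling) ≤⟨ potential ⟩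
    2 * size full + boundary full
      ≡⟨ cong₂ (λ p b → 2 * p + b) (size-full {n}) (count-empty (crossing? full) λ _ ()) ⟩
    2 * n + 0                                                 ≡⟨ +-identityʳ _ ⟩
    2 * n                                                     ∎)
    where open ≤-Reasoning

-- Tightness: the dipole

empty-convex : ∀ {n m} (G : Graph n m) → Loopless G → Convex G ⊥
empty-convex G loopless record { k = zero ; edges = edges ; joins = joins } v _ =
  ⊥-elim (loopless (edges zero) ([ same-ends , same-ends ] (joins zero)))
  where
  same-ends : ∀ {a} → G (edges zero) ≡ (a , a) → proj₁ (G (edges zero)) ≡ proj₂ (G (edges zero))
  same-ends eq = trans (cong proj₁ eq) (sym (cong proj₂ eq))
empty-convex G loopless record { k = suc _ ; verts-inj = verts-inj } v (_ , _ , outside) =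
  contradiction (verts-inj (trans (outside zero ∉⊥) (sym (outside (suc zero) ∉⊥)))) λ ()

hull-set-nonempty : ∀ {n m} (G : Graph n m) → Loopless G → ∀ {S} → HullSet G S → Fin n → 1 ≤ ∣ S ∣
hull-set-nonempty G loopless {S} hull v with nonempty? S
... | yes (x , x∈S) = ≤-trans (≤-reflexive (sym (∣⁅x⁆∣≡1 x)))
                              (p⊆q⇒∣p∣≤∣q∣ λ y∈⁅x⁆ → subst (_∈ S) (sym (x∈⁅y⁆⇒x≡y x y∈⁅x⁆)) x∈S)
... | no ¬nonempty  =
  contradiction (hull ⊥ (λ v∈S → contradiction (_ , v∈S) ¬nonempty) (empty-convex G loopless) v) ∉⊥

numClasses-by-invariant : ∀ {A : Set} {R : Rel A 0ℓ} {k} (class : A → Fin k) (rep : Fin k → A) →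
                          (∀ {x y} → R x y → class x ≡ class y) → (∀ i → class (rep i) ≡ i) →
                          (∀ x → EqClosure R (rep (class x)) x) → NumClasses R k
numClasses-by-invariant {R = R} class rep invariant section reach =
  rep , (λ x → class x , reach x) , λ i j r → trans (sym (section i)) (trans (preserved r) (section j))
  where
  preserved : ∀ {x y} → EqClosure R x y → class x ≡ class y
  preserved ε             = refl
  preserved (fwd r ◅ rs) = trans (invariant r) (preserved rs)
  preserved (bwd r ◅ rs) = trans (sym (invariant r)) (preserved rs)

dipole : Graph 2 4
dipole _ = zero , suc zero

module Dipole where

  csuc⁴ : ∀ (e : Fin 4) → csuc (csuc (csuc (csuc e))) ≡ e
  csuc⁴ zero                   = refl
  csuc⁴ (suc zero)             = refl
  csuc⁴ (suc (suc zero))       = refl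
  csuc⁴ (suc (suc (suc zero))) = refl

  csuc⁻¹ : Fin 4 → Fin 4
  csuc⁻¹ e = csuc (csuc (csuc e))

  -- σ turns the darts at one vertex forwards and those at the other backwards, so that all four faces
  -- are digons and 2 − 4 + 4 = 2.
  σ σ⁻¹ : Dart 4 → Dart 4
  σ (e , true)  = csuc e , true
  σ (e , false) = csuc⁻¹ e , false
  σ⁻¹ (e , true)  = csuc⁻¹ e , true
  σ⁻¹ (e , false) = csuc e , false

  Turn : Rel (Dart 4) 0ℓ
  Turn d d′ = d′ ≡ σ d

  from-base : ∀ b e → Star Turn (zero , b) (e , b)
  from-base true  zero                   = ε
  from-base true  (suc zero)             = refl ◅ ε
  from-base true  (suc (suc zero))       = refl ◅ refl ◅ ε
  from-base true  (suc (suc (suc zero))) = refl ◅ refl ◅ refl ◅ ε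
  from-base false zero                   = ε
  from-base false (suc zero)             = refl ◅ refl ◅ refl ◅ ε
  from-base false (suc (suc zero))       = refl ◅ refl ◅ ε
  from-base false (suc (suc (suc zero))) = refl ◅ ε

  to-base : ∀ b e → Star Turn (e , b) (zero , b)
  to-base true  zero                   = ε
  to-base true  (suc zero)             = refl ◅ refl ◅ refl ◅ ε
  to-base true  (suc (suc zero))       = refl ◅ refl ◅ ε
  to-base true  (suc (suc (suc zero))) = refl ◅ ε
  to-base false zero                   = ε
  to-base false (suc zero)             = refl ◅ ε
  to-base false (suc (suc zero))       = refl ◅ refl ◅ ε
  to-base false (suc (suc (suc zero))) = refl ◅ refl ◅ refl ◅ ε

  rotation : Rotation dipole
  rotation = record
    { σ       = σ
    ; σ⁻      = σ⁻¹
    ; σσ⁻     = λ { (e , true) → cong (_, true) (csuc⁴ e) ; (e , false) → cong (_, false) (csuc⁴ e) }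
    ; σ⁻σ     = λ { (e , true) → cong (_, true) (csuc⁴ e) ; (e , false) → cong (_, false) (csuc⁴ e) }
    ; σ-tail  = λ { (e , true) → refl ; (e , false) → refl }
    ; σ-trans = λ { (e , true) (e′ , true) _ → to-base true e ◅◅ from-base true e′
                  ; (e , false) (e′ , false) _ → to-base false e ◅◅ from-base false e′
                  ; (e , true) (e′ , false) () ; (e , false) (e′ , true) () }
    }

  vertex-classes : NumClasses Turn 2
  vertex-classes = numClasses-by-invariant side (λ i → zero , base i)
    (λ { {_ , true} refl → refl ; {_ , false} refl → refl })
    (λ { zero → refl ; (suc zero) → refl })
    (λ { (e , true) → Star.map fwd (from-base true e) ; (e , false) → Star.map fwd (from-base false e) })
    where
    side : Dart 4 → Fin 2
    side (_ , true)  = zero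
    side (_ , false) = suc zero
    base : Fin 2 → Bool
    base zero       = true
    base (suc zero) = false

  face-classes : NumClasses (λ d d′ → d′ ≡ σ (flip d)) 4
  face-classes = numClasses-by-invariant face (_, true)
    (λ { {e , true} refl → sym (csuc⁴ e) ; {_ , false} refl → refl })
    (λ _ → refl)
    (λ { (e , true) → ε ; (e , false) → fwd (cong (_, false) (sym (csuc⁴ e))) ◅ ε })
    where
    face : Dart 4 → Fin 4
    face (e , true)  = e
    face (e , false) = csuc e

  component-classes : NumClasses (λ d d′ → d′ ≡ σ d ⊎ d′ ≡ flip d) 1
  component-classes = numClasses-by-invariant (λ _ → zero) (λ _ → zero , true)
    (λ _ → refl)
    (λ { zero → refl ; (suc ()) })
    (λ { (e , true) → Star.map (fwd ∘ inj₁) (from-base true e)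
       ; (e , false) → fwd (inj₂ refl) ◅ Star.map (fwd ∘ inj₁) (from-base false e) })

dipole-planar : Planar dipole
dipole-planar = rotation , 2 , 4 , 1 , vertex-classes , face-classes , component-classes , refl
  where open Dipole

dipole-loopless : Loopless dipole
dipole-loopless _ ()

dipole-regular : FourRegular dipole
dipole-regular zero       = refl
dipole-regular (suc zero) = refl

dipole-hull-set : HullSet dipole ⁅ zero ⁆
dipole-hull-set C ⁅0⁆⊆C convex zero       = ⁅0⁆⊆C (x∈⁅x⁆ zero)
dipole-hull-set C ⁅0⁆⊆C convex (suc zero) =
  convex-absorbs-ear convex {e₁ = zero} {e₂ = suc zero} (λ ()) (inj₂ refl) (inj₂ refl) [ ⁅0⁆⊆C (x∈⁅x⁆ zero) ]
  where open Walks dipole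

theorem4 : (∀ {n m} (G : Graph n m) → Loopless G → FourRegular G → Planar G →
    ∃ λ (S : Subset n) → HullSet G S × 2 * ∣ S ∣ ≤ n)
    ×
    (Σ ℕ λ n → Σ ℕ λ m → Σ (Graph n m) λ G →
      1 ≤ n × Loopless G × FourRegular G × Planar G ×
      (∃ λ (S : Subset n) → HullSet G S × 2 * ∣ S ∣ ≡ n ×
        (∀ (S' : Subset n) → HullSet G S' → ∣ S ∣ ≤ ∣ S' ∣)))
theorem4 =
  (λ G loopless regular _ → hull-number-bound G loopless regular) ,
  (2 , 4 , dipole , s≤s z≤n , dipole-loopless , dipole-regular , dipole-planar ,
   ⁅ zero ⁆ , dipole-hull-set , refl , λ _ hull → hull-set-nonempty dipole dipole-loopless hull zero)
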